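{- Let $\theta$ be an ATL-formula and $\Sigma_\theta$ the set of agents occurring in $\theta$. If $\theta$ is tightly satisfiable (i.e. true at some state of some CGM with agent set $\Sigma_\theta$ under the standard perfect-recall semantics $\Vdash$), then $\theta$ is tightly satisfiable in a positional CGM, i.e. there is a CGM $\mathcal{M}$ with agent set $\Sigma_\theta$ and a state $s$ with $\mathcal{M},s\Vdash_{pos}\theta$.
   Context: ATL-formulae over a set AP of atoms and a finite non-empty agent set $\Sigma$: $\varphi ::= p \mid \neg\varphi \mid (\varphi_1\to\varphi_2)\mid \langle\langle A\rangle\rangle\bigcirc\varphi \mid \langle\langle A\rangle\rangle\Box\varphi \mid \langle\langle A\rangle\rangle \varphi_1\,\mathcal{U}\,\varphi_2$, $A\subseteq\Sigma$. A CGM is $\mathcal{M}=(\Sigma,S,d,\delta,AP,L)$ with $S\ne\emptyset$, $d_a(s)\ge1$ moves $D_a(s)=\{0,\dots,d_a(s)-1\}$ for agent $a$ at $s$, move vectors $D(s)=\prod_a D_a(s)$, transition $\delta(s,\sigma)\in S$, labeling $L:S\to\mathcal P(AP)$. An $A$-move at $s$ picks a move for each $a\in A$; $out(s,\sigma_A)=\{\delta(s,\sigma):\sigma\text{ agrees with }\sigma_A\text{ on }A\}$. A perfect-recall $A$-strategy assigns to each non-empty finite sequence of states ending in $t$ an $A$-move at $t$; a positional $A$-strategy assigns to each state $t$ an $A$-move at $t$. The outcome $out(s,F)$ of a strategy $F$ is the set of infinite state sequences $\lambda$ with $\lambda[0]=s$ and $\lambda[i+1]\in out(\lambda[i],\sigma^i)$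 where $\sigma^i$ is $F$ applied to $\lambda[0..i]$ (perfect recall) or to $\lambda[i]$ (positional). The relation $\Vdash$ (resp. $\Vdash_{pos}$) is defined by: $s\Vdash p$ iff $p\in L(s)$; Boolean clauses as usual; $s\Vdash\langle\langle A\rangle\rangle\bigcirc\varphi$ iff some $A$-move at $s$ has $\varphi$ true on all its outcome states; $s\Vdash\langle\langle A\rangle\rangle\Box\varphi$ iff some perfect-recall (resp. positional) $A$-strategy $F$ has $\varphi$ true at all positions of all $\lambda\in out(s,F)$; $s\Vdash\langle\langle A\rangle\rangle\varphi\,\mathcal{U}\,\psi$ iff some perfect-recall (resp. positional) $A$-strategy $F$ ensures that every $\lambda\in out(s,F)$ has an $i$ with $\psi$ true at $\lambda[i]$ and $\varphi$ true at $\lambda[j]$ for all $j<i$. -}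

module Defs where

open import Data.Nat using (ℕ; zero; suc; _≤_; _<_; _≟_)
open import Data.Fin using (Fin)
open import Data.List using (List; []; _∷_; _++_; map; upTo)
open import Data.List.Membership.DecPropositional _≟_ using (_∈?_)
open import Data.Product using (Σ; ∃; _×_; _,_; proj₁)
open import Relation.Nullary using (¬_)
open import Relation.Nullary.Decidable using (True)
open import Relation.Binary.PropositionalEquality using (_≡_)
open import Level using (Level) renaming (suc to lsuc; zero to lzero)

-- Atoms and agents are natural numbers; a coalition A is a finite
-- set of agents, given as a list (only membership matters).
Atom : Set
Atom = ℕ

AgentName : Set
AgentName = ℕ

Coalition : Set
Coalition = List AgentName

data Fml : Set where
  atom   : Atom → Fml
  ¬'_    : Fml → Fml
  _⇒_    : Fml → Fml → Fml
  ⟪_⟫○_  : Coalition → Fml → Fml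
  ⟪_⟫□_  : Coalition → Fml → Fml
  ⟪_⟫_U_ : Coalition → Fml → Fml → Fml

agents : Fml → List AgentName
agents (atom p) = []
agents (¬' φ) = agents φ
agents (φ ⇒ ψ) = agents φ ++ agents ψ
agents (⟪ A ⟫○ φ) = A ++ agents φ
agents (⟪ A ⟫□ φ) = A ++ agents φ
agents (⟪ A ⟫ φ U ψ) = A ++ agents φ ++ agents ψ

-- The agents of a model whose agent set is (the set of members of) X.
-- True (a ∈? X) is ⊤ or ⊥, so each agent has a unique witness.
Agt : List AgentName → Set
Agt X = Σ AgentName (λ a → True (a ∈? X))

_∈A_ : {X : List AgentName} → Agt X → Coalition → Set
a ∈A A = True (proj₁ a ∈? A)

record CGM (X : List AgentName) : Set₁ where
  field
    S        : Set
    S-inh    : S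
    agt-inh  : Agt X
    d        : Agt X → S → ℕ                       -- D_a(s) = Fin (d a s)
    d≥1      : ∀ a s → 1 ≤ d a s
    δ        : (s : S) → ((a : Agt X) → Fin (d a s)) → S
    L        : S → Atom → Set

data Mode : Set where
  perfectRecall positional : Mode

module _ {X : List AgentName} (M : CGM X) where
  open CGM M

  MoveVec : S → Set
  MoveVec s = (a : Agt X) → Fin (d a s)

  AMove : Coalition → S → Set
  AMove A s = (a : Agt X) → a ∈A A → Fin (d a s)

  InOut : {A : Coalition} (s : S) → AMove A s → S → Set
  InOut {A} s σA t =
    Σ (MoveVec s) λ σ → ((a : Agt X) (p : a ∈A A) → σ a ≡ σA a p) × (δ s σ ≡ t)

  -- perfect-recall strategy: history given as (states before, last state t)
  PRStrat : Coalition → Set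
  PRStrat A = (h : List S) (t : S) → AMove A t

  PosStrat : Coalition → Set
  PosStrat A = (t : S) → AMove A t

  Path : Set
  Path = ℕ → S

  before : Path → ℕ → List S
  before λ' i = map λ' (upTo i)

  IsOutcome : {A : Coalition} → S → ((λ' : Path) (i : ℕ) → AMove A (λ' i)) → Path → Set
  IsOutcome s choose λ' = (λ' 0 ≡ s) × (∀ i → InOut (λ' i) (choose λ' i) (λ' (suc i)))

  Wins : Mode → S → Coalition → (Path → Set) → Set
  Wins perfectRecall s A P =
    Σ (PRStrat A) λ F → ∀ λ' → IsOutcome s (λ λ'' i → F (before λ'' i) (λ'' i)) λ' → P λ'
  Wins positional s A P =
    Σ (PosStrat A) λ F → ∀ λ' → IsOutcome s (λ λ'' i → F (λ'' i)) λ' → P λ'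

  Sat : Mode → S → Fml → Set
  Sat m s (atom p) = L s p
  Sat m s (¬' φ) = ¬ Sat m s φ
  Sat m s (φ ⇒ ψ) = Sat m s φ → Sat m s ψ
  Sat m s (⟪ A ⟫○ φ) = Σ (AMove A s) λ σA → ∀ t → InOut s σA t → Sat m t φ
  Sat m s (⟪ A ⟫□ φ) = Wins m s A (λ λ' → ∀ i → Sat m (λ' i) φ)
  Sat m s (⟪ A ⟫ φ U ψ) =
    Wins m s A (λ λ' → Σ ℕ λ i → Sat m (λ' i) ψ × (∀ j → j < i → Sat m (λ' j) φ))

_,_⊩_ : {X : List AgentName} (M : CGM X) → CGM.S M → Fml → Set
M , s ⊩ θ = Sat M perfectRecall s θ

_,_⊩pos_ : {X : List AgentName} (M : CGM X) → CGM.S M → Fml → Set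
M , s ⊩pos θ = Sat M positional s θ

-- The unfolding of a model M has as states the pairs (h , t) of a finite
-- history h of M and a current state t, and moves exactly as M does at t
-- while appending t to the history.  A perfect-recall strategy of M is then
-- a positional strategy of the unfolding and conversely, so every formula
-- holds positionally at (h , t) in the unfolding iff it holds at t in M
-- under perfect recall.  The unfolding has the same agents as M.
module Submission where

open import Defs
open import Data.Product using (Σ; _×_; _,_; proj₁; proj₂)
open import Data.Nat using (ℕ; zero; suc; _<_)
open import Data.List using (List; []; _∷_; _++_; _∷ʳ_; map; upTo; drop; length)
open import Data.List.Properties using (++-identityʳ; ++-assoc; map-++; upTo-∷ʳ)
open import Function using (_∘_)
open import Function.Bundles using (_⇔_; mk⇔; Equivalence)
open import Relation.Binary.PropositionalEquality
  using (_≡_; refl; sym; trans; cong; cong₂; subst; module ≡-Reasoning)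
open import Function.Properties.Equivalence using ()
  renaming (refl to ⇔-refl; trans to ⇔-trans)

open Equivalence using (to; from)

drop-length-++ : {A : Set} (xs ys : List A) → drop (length xs) (xs ++ ys) ≡ ys
drop-length-++ []       ys = refl
drop-length-++ (x ∷ xs) ys = drop-length-++ xs ys

map-upTo-suc : {A : Set} (f : ℕ → A) (i : ℕ) →
  map f (upTo (suc i)) ≡ map f (upTo i) ∷ʳ f i
map-upTo-suc f i = trans (cong (map f) (sym (upTo-∷ʳ i))) (map-++ f (upTo i) (i ∷ []))

Wins-cong : ∀ {X} {N : CGM X} (m : Mode) {s A} {P Q : Path N → Set} →
  (∀ λ' → P λ' ⇔ Q λ') → Wins N m s A P ⇔ Wins N m s A Q
Wins-cong perfectRecall P⇔Q =
  mk⇔ (λ (F , w) → F , λ λ' o → to (P⇔Q λ') (w λ' o))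
      (λ (F , w) → F , λ λ' o → from (P⇔Q λ') (w λ' o))
Wins-cong positional P⇔Q =
  mk⇔ (λ (F , w) → F , λ λ' o → to (P⇔Q λ') (w λ' o))
      (λ (F , w) → F , λ λ' o → from (P⇔Q λ') (w λ' o))

module Unfolding {X : List AgentName} (M : CGM X) where
  open CGM M

  unfold : CGM X
  unfold = record
    { S       = List S × S
    ; S-inh   = [] , S-inh
    ; agt-inh = agt-inh
    ; d       = λ a (h , t) → d a t
    ; d≥1     = λ a (h , t) → d≥1 a t
    ; δ       = λ (h , t) σ → h ∷ʳ t , δ t σ
    ; L       = λ (h , t) → L t
    }

  current : Path unfold → Path M
  current Λ i = proj₂ (Λ i)

  lift : List S → Path M → Path unfold
  lift pre λ' i = pre ++ before M λ' i , λ' i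

  lift-suc : ∀ pre λ' i → proj₁ (lift pre λ' i) ∷ʳ λ' i ≡ proj₁ (lift pre λ' (suc i))
  lift-suc pre λ' i = begin
    (pre ++ before M λ' i) ∷ʳ λ' i   ≡⟨ ++-assoc pre (before M λ' i) (λ' i ∷ []) ⟩
    pre ++ (before M λ' i ∷ʳ λ' i)   ≡⟨ cong (pre ++_) (sym (map-upTo-suc λ' i)) ⟩
    pre ++ before M λ' (suc i)       ∎
    where open ≡-Reasoning

  history-of-outcome : ∀ {A} pre t (choose : (Λ : Path unfold) (i : ℕ) → AMove unfold A (Λ i))
    (Λ : Path unfold) → IsOutcome unfold (pre , t) choose Λ →
    ∀ i → proj₁ (Λ i) ≡ proj₁ (lift pre (current Λ) i)
  history-of-outcome pre t choose Λ (Λ0 , steps) = go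
    where
    go : ∀ i → proj₁ (Λ i) ≡ proj₁ (lift pre (current Λ) i)
    go zero = trans (cong proj₁ Λ0) (sym (++-identityʳ pre))
    go (suc i) with steps i
    ... | _ , _ , δ≡ = trans (sym (cong proj₁ δ≡))
                         (trans (cong (_∷ʳ current Λ i) (go i)) (lift-suc pre (current Λ) i))

  -- Played from (pre , t), the histories of the unfolding start with pre,
  -- which a strategy of M started at t must not see.
  positional-of : ∀ {A} → List S → PRStrat M A → PosStrat unfold A
  positional-of pre G (h , t) = G (drop (length pre) h) t

  recall-of : ∀ {A} → List S → PosStrat unfold A → PRStrat M A
  recall-of pre F h t = F (pre ++ h , t)

  Wins-unfold : ∀ pre t A (P : Path M → Set) →
    Wins unfold positional (pre , t) A (P ∘ current) ⇔ Wins M perfectRecall t A P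
  Wins-unfold pre t A P = mk⇔ pos⇒pr pr⇒pos
    where
    pos⇒pr : Wins unfold positional (pre , t) A (P ∘ current) → Wins M perfectRecall t A P
    pos⇒pr (F , win) = recall-of pre F , λ λ' (λ0 , steps) →
      win (lift pre λ') (cong₂ _,_ (++-identityʳ pre) λ0 , λ i →
        let σ , agree , δ≡ = steps i in σ , agree , cong₂ _,_ (lift-suc pre λ' i) δ≡)

    pr⇒pos : Wins M perfectRecall t A P → Wins unfold positional (pre , t) A (P ∘ current)
    pr⇒pos (G , win) = positional-of pre G , λ Λ outcome@(Λ0 , steps) →
      win (current Λ) (cong proj₂ Λ0 , λ i →
        let σ , agree , δ≡ = steps i
            recalled : drop (length pre) (proj₁ (Λ i)) ≡ before M (current Λ) i
            recalled = trans (cong (drop (length pre))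
                                   (history-of-outcome pre t (λ Λ′ i′ → positional-of pre G (Λ′ i′)) Λ outcome i))
                             (drop-length-++ pre _)
        in σ , (λ a p → trans (agree a p) (cong (λ h → G h (current Λ i) a p) recalled))
             , cong proj₂ δ≡)

  Sat-unfold : ∀ φ (h : CGM.S unfold) →
    Sat unfold positional h φ ⇔ Sat M perfectRecall (proj₂ h) φ
  Sat-unfold (atom p) h = ⇔-refl
  Sat-unfold (¬' φ) h =
    mk⇔ (λ ¬φ φ′ → ¬φ (from (Sat-unfold φ h) φ′)) (λ ¬φ φ′ → ¬φ (to (Sat-unfold φ h) φ′))
  Sat-unfold (φ ⇒ ψ) h =
    mk⇔ (λ f x → to (Sat-unfold ψ h) (f (from (Sat-unfold φ h) x)))
        (λ f x → from (Sat-unfold ψ h) (f (to (Sat-unfold φ h) x)))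
  Sat-unfold (⟪ A ⟫○ φ) (pre , t) =
    mk⇔ (λ (σA , w) → σA , λ u (σ , agree , δ≡) →
           to (Sat-unfold φ _) (subst (λ v → Sat unfold positional v φ)
                                  (cong (pre ∷ʳ t ,_) δ≡) (w _ (σ , agree , refl))))
        (λ (σA , w) → σA , λ u (σ , agree , δ≡) →
           from (Sat-unfold φ u) (w _ (σ , agree , cong proj₂ δ≡)))
  Sat-unfold (⟪ A ⟫□ φ) (pre , t) =
    ⇔-trans (Wins-cong {N = unfold} positional always) (Wins-unfold pre t A _)
    where
    always : ∀ Λ → (∀ i → Sat unfold positional (Λ i) φ)
                 ⇔ (∀ i → Sat M perfectRecall (current Λ i) φ)
    always Λ = mk⇔ (λ q i → to (Sat-unfold φ (Λ i)) (q i))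
                   (λ q i → from (Sat-unfold φ (Λ i)) (q i))
  Sat-unfold (⟪ A ⟫ φ U ψ) (pre , t) =
    ⇔-trans (Wins-cong {N = unfold} positional until) (Wins-unfold pre t A _)
    where
    until : ∀ Λ →
      Σ ℕ (λ i → Sat unfold positional (Λ i) ψ × (∀ j → j < i → Sat unfold positional (Λ j) φ))
      ⇔ Σ ℕ (λ i → Sat M perfectRecall (current Λ i) ψ × (∀ j → j < i → Sat M perfectRecall (current Λ j) φ))
    until Λ =
      mk⇔ (λ (i , q , r) → i , to (Sat-unfold ψ (Λ i)) q , λ j j<i → to (Sat-unfold φ (Λ j)) (r j j<i))
          (λ (i , q , r) → i , from (Sat-unfold ψ (Λ i)) q , λ j j<i → from (Sat-unfold φ (Λ j)) (r j j<i))

mainTheorem3 : (θ : Fml) →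
    Σ (CGM (agents θ)) (λ M → Σ (CGM.S M) (λ s → M , s ⊩ θ)) →
    Σ (CGM (agents θ)) (λ M → Σ (CGM.S M) (λ s → M , s ⊩pos θ))
mainTheorem3 θ (M , s , M,s⊩θ) = unfold , ([] , s) , from (Sat-unfold θ ([] , s)) M,s⊩θ
  where open Unfolding M
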